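{- Let $n\ge 1$ and let $A$ be the $n\times n$ matrix with entries $A_{ij}=(1-x^i)^{n+1-j}(1-x^{i+1})^{n+1-j}x^{i(j-1)}$, $1\le i,j\le n$, where $x$ is an indeterminate. Then \[ \det A=(-1)^{\frac{n(n-1)}{2}}x^{\frac{n(n^2-1)}{6}}\prod_{k=1}^{n}(1-x^{2k-1})^{n+1-k}(1-x^{2k})^{n+1-k}. \] -}

module Defs where

open import Algebra.Bundles using (CommutativeRing)
open import Data.Nat as ℕ using (ℕ; zero; suc)
open import Data.Nat.DivMod using (_/_)
open import Data.Fin using (Fin; zero; suc; toℕ; punchIn)

module RingDefs {c ℓ} (R : CommutativeRing c ℓ) where
  open CommutativeRing R hiding (zero)

  pow : Carrier → ℕ → Carrier
  pow a zero    = 1#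
  pow a (suc k) = a * pow a k

  sign : ℕ → Carrier
  sign zero    = 1#
  sign (suc k) = - sign k

  sumFin : ∀ {n} → (Fin n → Carrier) → Carrier
  sumFin {zero}  f = 0#
  sumFin {suc n} f = f zero + sumFin (λ i → f (suc i))

  prodFrom1 : (ℕ → Carrier) → ℕ → Carrier
  prodFrom1 f zero    = 1#
  prodFrom1 f (suc m) = prodFrom1 f m * f (suc m)

  det : ∀ n → (Fin n → Fin n → Carrier) → Carrier
  det zero    M = 1#
  det (suc n) M =
    sumFin (λ j → sign (toℕ j) * M zero j * det n (λ i k → M (suc i) (punchIn j k)))

  -- The matrix A of the lemma, 1-based indices i = 1 + toℕ i₀, j = 1 + toℕ j₀:
  -- A_ij = (1 - x^i)^(n+1-j) (1 - x^(i+1))^(n+1-j) x^(i(j-1))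
  matA : Carrier → (n : ℕ) → Fin n → Fin n → Carrier
  matA x n i₀ j₀ =
    let i = suc (toℕ i₀)
        j = suc (toℕ j₀)
    in pow (1# - pow x i) (n ℕ.∸ toℕ j₀)
       * pow (1# - pow x (suc i)) (n ℕ.∸ toℕ j₀)
       * pow x (i ℕ.* (j ℕ.∸ 1))

  rhsA : Carrier → ℕ → Carrier
  rhsA x n =
    sign ((n ℕ.* (n ℕ.∸ 1)) / 2)
    * pow x ((n ℕ.* (n ℕ.* n ℕ.∸ 1)) / 6)
    * prodFrom1 (λ k → pow (1# - pow x (2 ℕ.* k ℕ.∸ 1)) (suc n ℕ.∸ k)
                      * pow (1# - pow x (2 ℕ.* k)) (suc n ℕ.∸ k)) n

{-# OPTIONS --safe #-}
module Submission where

-- Write aᵢ = (1 - xⁱ)(1 - xⁱ⁺¹) and bᵢ = xⁱ. Row i of A is aᵢ times the row (aᵢⁿ⁻ʲ bᵢʲ⁻¹)ⱼ of a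
-- homogeneous Vandermonde matrix, so det A = ∏ᵢ aᵢ · ∏_{i<j} (aᵢ bⱼ - aⱼ bᵢ). Each factor is
-- aᵢ bⱼ - aⱼ bᵢ = -xⁱ (1 - xʲ⁻ⁱ)(1 - xⁱ⁺ʲ⁺¹), and for every j the new factors
-- aⱼ ∏_{i<j} (aᵢ bⱼ - aⱼ bᵢ) = (-1)ʲ⁻¹ x^(j(j-1)/2) ∏_{m=1}^{2j} (1 - xᵐ) are exactly the ratio of
-- the right-hand sides for n = j and n = j - 1.
--
-- Over an arbitrary commutative ring the Vandermonde determinant is evaluated without division:
-- aᵢ + tᵢ bᵢ = 1 for tᵢ = 1 + x - xⁱ⁺¹, and the shear (a, b) ↦ (a + t₁ b, b), which is a product of
-- adjacent column operations and leaves every aᵢ bⱼ - aⱼ bᵢ unchanged, makes a₁ = 1. Eliminating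
-- along the first row then reduces the size by one.

open import Defs
open import Algebra.Bundles using (CommutativeRing)
open import Algebra.Solver.Ring.AlmostCommutativeRing using (fromCommutativeRing; _-Raw-AlmostCommutative⟶_)
open import Data.Empty using (⊥-elim)
open import Data.Fin using (Fin; toℕ; punchIn)
import Data.Fin.Properties as Finₚ
open import Data.Integer as ℤ using (ℤ; +_; -[1+_])
import Data.Integer.Properties as ℤₚ
open import Data.Maybe using (map)
open import Data.Nat as ℕ using (ℕ; zero; suc; _<_; _≤_; z≤n; s≤s; _∸_; _≟_)
open import Data.Nat.Combinatorics using (_C_; nC1≡n; nCk≡nPk/k!; nCk+nC[k+1]≡[n+1]C[k+1])
open import Data.Nat.DivMod using (_/_)
import Data.Nat.Properties as ℕₚ
open import Data.Nat.Tactic.RingSolver using (solve-∀)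
open import Data.Product using (∃-syntax; _×_; _,_; proj₁; proj₂)
open import Data.Sign as Sign using (Sign)
open import Data.Sum using (_⊎_; inj₁; inj₂)
open import Function using (_∘_)
open import Relation.Binary.Definitions using (tri<; tri≈; tri>)
open import Relation.Binary.PropositionalEquality as ≡ using (_≡_; _≢_)
open import Relation.Nullary using (yes; no)
open import Relation.Nullary.Decidable using (dec⇒maybe)

[1+n]C2≡nC2+n : ∀ n → suc n C 2 ≡ n C 2 ℕ.+ n
[1+n]C2≡nC2+n n = ≡.trans (≡.sym (nCk+nC[k+1]≡[n+1]C[k+1] n 1))
                          (≡.trans (≡.cong (ℕ._+ n C 2) (nC1≡n n)) (ℕₚ.+-comm n (n C 2)))

[1+n]C3≡nC3+nC2 : ∀ n → suc n C 3 ≡ n C 3 ℕ.+ n C 2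
[1+n]C3≡nC3+nC2 n = ≡.trans (≡.sym (nCk+nC[k+1]≡[n+1]C[k+1] n 2)) (ℕₚ.+-comm (n C 2) (n C 3))

-- In the next two proofs the right-hand side of `falling` is what n P 2, resp. (1 + n) P 3, unfolds to.

n*[n∸1]/2≡nC2 : ∀ n → n ℕ.* (n ∸ 1) / 2 ≡ n C 2
n*[n∸1]/2≡nC2 0 = ≡.refl
n*[n∸1]/2≡nC2 1 = ≡.refl
n*[n∸1]/2≡nC2 n@(suc (suc k)) =
  ≡.trans (≡.cong (_/ 2) (falling k)) (≡.sym (nCk≡nPk/k! {2} {n} (s≤s (s≤s z≤n))))
  where
  falling : ∀ k → suc (suc k) ℕ.* suc k ≡ suc k ℕ.* (suc (suc k) ℕ.* 1)
  falling = solve-∀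

n*[n*n∸1]/6≡[1+n]C3 : ∀ n → n ℕ.* (n ℕ.* n ∸ 1) / 6 ≡ suc n C 3
n*[n*n∸1]/6≡[1+n]C3 0 = ≡.refl
n*[n*n∸1]/6≡[1+n]C3 1 = ≡.refl
n*[n*n∸1]/6≡[1+n]C3 n@(suc (suc k)) =
  ≡.trans (≡.cong (_/ 6) (falling k)) (≡.sym (nCk≡nPk/k! {3} {suc n} (s≤s (s≤s (s≤s z≤n)))))
  where
  falling : ∀ k → suc (suc k) ℕ.* (suc k ℕ.+ suc k ℕ.* suc (suc k))
                  ≡ suc k ℕ.* (suc (suc k) ℕ.* (suc (suc (suc k)) ℕ.* 1))
  falling = solve-∀

module Determinants {c ℓ} (R : CommutativeRing c ℓ) where
  open CommutativeRing R hiding (zero)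
  open RingDefs R
  open import Algebra.Properties.Ring ring
    using (-‿distribˡ-*; -‿distribʳ-*; -0#≈0#; -‿involutive; -‿+-comm; -1*x≈-x)
  open import Algebra.Properties.Semiring.Mult.TCOptimised semiring as Mult using (×-homo-+; ×1-homo-*; 1+×)
  open import Algebra.Properties.Semiring.Exp semiring using (_^_; ^-congˡ; ^-congʳ; ^-homo-*; ^-assocʳ)
  open import Algebra.Properties.CommutativeSemiring.Exp commutativeSemiring using (^-distrib-*)
  open import Algebra.Properties.CommutativeSemigroup *-commutativeSemigroup using (interchange)
  open import Algebra.Properties.CommutativeSemigroup +-commutativeSemigroup
    using () renaming (interchange to +-interchange)
  open import Relation.Binary.Reasoning.Setoid setoid

  -- Integer coefficients for the ring solver

  fromℕ : ℕ → Carrier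
  fromℕ n = n Mult.× 1#

  fromℤ : ℤ → Carrier
  fromℤ (+ n)    = fromℕ n
  fromℤ -[1+ n ] = - fromℕ (suc n)

  fromℤ-neg : ∀ i → fromℤ (ℤ.- i) ≈ - fromℤ i
  fromℤ-neg (+ zero)  = sym -0#≈0#
  fromℤ-neg (+ suc n) = refl
  fromℤ-neg -[1+ n ]  = sym (-‿involutive _)

  fromℤ-⊖ : ∀ m n → fromℤ (m ℤ.⊖ n) ≈ fromℕ m - fromℕ n
  fromℤ-⊖ zero    zero    = sym (-‿inverseʳ 0#)
  fromℤ-⊖ zero    (suc n) = sym (+-identityˡ _)
  fromℤ-⊖ (suc m) zero    = sym (trans (+-congˡ -0#≈0#) (+-identityʳ _))
  fromℤ-⊖ (suc m) (suc n) = begin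
    fromℤ (suc m ℤ.⊖ suc n)               ≡⟨ ≡.cong fromℤ (ℤₚ.[1+m]⊖[1+n]≡m⊖n m n) ⟩
    fromℤ (m ℤ.⊖ n)                       ≈⟨ fromℤ-⊖ m n ⟩
    fromℕ m - fromℕ n                     ≈⟨ +-identityˡ _ ⟨
    0# + (fromℕ m - fromℕ n)              ≈⟨ +-congʳ (-‿inverseʳ 1#) ⟨
    (1# - 1#) + (fromℕ m - fromℕ n)       ≈⟨ +-assoc 1# (- 1#) _ ⟩
    1# + (- 1# + (fromℕ m - fromℕ n))     ≈⟨ +-congˡ (+-assoc (- 1#) _ _) ⟨
    1# + ((- 1# + fromℕ m) - fromℕ n)     ≈⟨ +-congˡ (+-congʳ (+-comm (- 1#) _)) ⟩
    1# + ((fromℕ m - 1#) - fromℕ n)       ≈⟨ +-congˡ (+-assoc _ (- 1#) _) ⟩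
    1# + (fromℕ m + (- 1# - fromℕ n))     ≈⟨ +-assoc 1# _ _ ⟨
    (1# + fromℕ m) + (- 1# - fromℕ n)     ≈⟨ +-cong (sym (1+× m 1#)) (-‿+-comm 1# (fromℕ n)) ⟩
    fromℕ (suc m) - (1# + fromℕ n)        ≈⟨ +-congˡ (-‿cong (sym (1+× n 1#))) ⟩
    fromℕ (suc m) - fromℕ (suc n)         ∎

  fromℤ-+ : ∀ i j → fromℤ (i ℤ.+ j) ≈ fromℤ i + fromℤ j
  fromℤ-+ (+ m)    (+ n)    = ×-homo-+ 1# m n
  fromℤ-+ (+ m)    -[1+ n ] = fromℤ-⊖ m (suc n)
  fromℤ-+ -[1+ m ] (+ n)    = trans (fromℤ-⊖ n (suc m)) (+-comm _ _)
  fromℤ-+ -[1+ m ] -[1+ n ] = begin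
    - fromℕ (suc (suc (m ℕ.+ n)))         ≡⟨ ≡.cong (λ k → - fromℕ (suc k)) (ℕₚ.+-suc m n) ⟨
    - fromℕ (suc m ℕ.+ suc n)             ≈⟨ -‿cong (×-homo-+ 1# (suc m) (suc n)) ⟩
    - (fromℕ (suc m) + fromℕ (suc n))     ≈⟨ -‿+-comm _ _ ⟨
    - fromℕ (suc m) - fromℕ (suc n)       ∎

  fromℤ[-◃n]≈-n : ∀ n → fromℤ (Sign.- ℤ.◃ n) ≈ - fromℕ n
  fromℤ[-◃n]≈-n zero    = sym -0#≈0#
  fromℤ[-◃n]≈-n (suc n) = refl

  fromℤ-* : ∀ i j → fromℤ (i ℤ.* j) ≈ fromℤ i * fromℤ j
  fromℤ-* (+ m) (+ n) = begin
    fromℤ (Sign.+ ℤ.◃ m ℕ.* n)            ≡⟨ ≡.cong fromℤ (ℤₚ.+◃n≡+n (m ℕ.* n)) ⟩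
    fromℕ (m ℕ.* n)                       ≈⟨ ×1-homo-* m n ⟩
    fromℕ m * fromℕ n                     ∎
  fromℤ-* (+ m) -[1+ n ] = begin
    fromℤ (Sign.- ℤ.◃ m ℕ.* suc n)        ≈⟨ fromℤ[-◃n]≈-n (m ℕ.* suc n) ⟩
    - fromℕ (m ℕ.* suc n)                 ≈⟨ -‿cong (×1-homo-* m (suc n)) ⟩
    - (fromℕ m * fromℕ (suc n))           ≈⟨ -‿distribʳ-* _ _ ⟩
    fromℕ m * - fromℕ (suc n)             ∎
  fromℤ-* -[1+ m ] (+ n) = begin
    fromℤ (Sign.- ℤ.◃ suc m ℕ.* n)        ≈⟨ fromℤ[-◃n]≈-n (suc m ℕ.* n) ⟩
    - fromℕ (suc m ℕ.* n)                 ≈⟨ -‿cong (×1-homo-* (suc m) n) ⟩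
    - (fromℕ (suc m) * fromℕ n)           ≈⟨ -‿distribˡ-* _ _ ⟩
    - fromℕ (suc m) * fromℕ n             ∎
  fromℤ-* -[1+ m ] -[1+ n ] = begin
    fromℕ (suc m ℕ.* suc n)               ≈⟨ ×1-homo-* (suc m) (suc n) ⟩
    fromℕ (suc m) * fromℕ (suc n)         ≈⟨ -‿involutive _ ⟨
    - - (fromℕ (suc m) * fromℕ (suc n))   ≈⟨ -‿cong (-‿distribˡ-* _ _) ⟩
    - (- fromℕ (suc m) * fromℕ (suc n))   ≈⟨ -‿distribʳ-* _ _ ⟩
    - fromℕ (suc m) * - fromℕ (suc n)     ∎

  fromℤ-morphism : ℤ.+-*-rawRing -Raw-AlmostCommutative⟶ fromCommutativeRing R
  fromℤ-morphism = record
    { ⟦_⟧ = fromℤ ; +-homo = fromℤ-+ ; *-homo = fromℤ-* ; -‿homo = fromℤ-neg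
    ; 0-homo = refl ; 1-homo = refl }

  open import Algebra.Solver.Ring ℤ.+-*-rawRing (fromCommutativeRing R) fromℤ-morphism
    (λ i j → map (λ i≡j → reflexive (≡.cong fromℤ i≡j)) (dec⇒maybe (i ℤ.≟ j)))

  pow≡^ : ∀ y k → pow y k ≡ y ^ k
  pow≡^ y zero    = ≡.refl
  pow≡^ y (suc k) = ≡.cong (y *_) (pow≡^ y k)

  1#^n≈1# : ∀ n → 1# ^ n ≈ 1#
  1#^n≈1# zero    = refl
  1#^n≈1# (suc n) = trans (*-identityˡ _) (1#^n≈1# n)

  sign-+ : ∀ m n → sign (m ℕ.+ n) ≈ sign m * sign n
  sign-+ zero    n = sym (*-identityˡ _)
  sign-+ (suc m) n = trans (-‿cong (sign-+ m n)) (-‿distribˡ-* _ _)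

  prod : ℕ → (ℕ → Carrier) → Carrier
  prod zero    f = 1#
  prod (suc n) f = prod n f * f n

  prodFrom1≡prod : ∀ (f : ℕ → Carrier) n → prodFrom1 f n ≡ prod n (λ k → f (suc k))
  prodFrom1≡prod f zero    = ≡.refl
  prodFrom1≡prod f (suc n) = ≡.cong (_* f (suc n)) (prodFrom1≡prod f n)

  prod-cong : ∀ n {f g : ℕ → Carrier} → (∀ i → i < n → f i ≈ g i) → prod n f ≈ prod n g
  prod-cong zero    f≈g = refl
  prod-cong (suc n) f≈g = *-cong (prod-cong n (λ i i<n → f≈g i (ℕₚ.m<n⇒m<1+n i<n))) (f≈g n ℕₚ.≤-refl)

  prod-head : ∀ n (f : ℕ → Carrier) → prod (suc n) f ≈ f 0 * prod n (λ i → f (suc i))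
  prod-head zero    f = trans (*-identityˡ _) (sym (*-identityʳ _))
  prod-head (suc n) f = trans (*-congʳ (prod-head n f)) (*-assoc _ _ _)

  prod-* : ∀ n (f g : ℕ → Carrier) → prod n (λ i → f i * g i) ≈ prod n f * prod n g
  prod-* zero    f g = sym (*-identityˡ 1#)
  prod-* (suc n) f g = trans (*-congʳ (prod-* n f g)) (interchange _ _ _ _)

  prod-+ : ∀ m n (f : ℕ → Carrier) → prod (m ℕ.+ n) f ≈ prod m f * prod n (λ i → f (m ℕ.+ i))
  prod-+ m zero    f = begin
    prod (m ℕ.+ 0) f    ≡⟨ ≡.cong (λ k → prod k f) (ℕₚ.+-identityʳ m) ⟩
    prod m f            ≈⟨ *-identityʳ _ ⟨
    prod m f * 1#       ∎
  prod-+ m (suc n) f = begin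
    prod (m ℕ.+ suc n) f                                    ≡⟨ ≡.cong (λ k → prod k f) (ℕₚ.+-suc m n) ⟩
    prod (m ℕ.+ n) f * f (m ℕ.+ n)                          ≈⟨ *-congʳ (prod-+ m n f) ⟩
    prod m f * prod n (λ i → f (m ℕ.+ i)) * f (m ℕ.+ n)     ≈⟨ *-assoc _ _ _ ⟩
    prod m f * prod (suc n) (λ i → f (m ℕ.+ i))             ∎

  prod-neg : ∀ n (f : ℕ → Carrier) → prod n (λ i → - f i) ≈ sign n * prod n f
  prod-neg zero    f = sym (*-identityˡ 1#)
  prod-neg (suc n) f = begin
    prod n (λ i → - f i) * - f n        ≈⟨ *-cong (prod-neg n f) (sym (-1*x≈-x (f n))) ⟩
    sign n * prod n f * (- 1# * f n)    ≈⟨ interchange _ _ _ _ ⟩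
    sign n * - 1# * (prod n f * f n)    ≈⟨ *-congʳ (trans (*-comm _ _) (-1*x≈-x (sign n))) ⟩
    - sign n * (prod n f * f n)         ∎

  prod-reverse : ∀ n (f : ℕ → Carrier) → prod n (λ i → f (n ∸ i)) ≈ prod n (λ i → f (suc i))
  prod-reverse zero    f = refl
  prod-reverse (suc n) f = begin
    prod n (λ i → f (suc n ∸ i)) * f (suc n ∸ n)
      ≈⟨ *-cong (prod-cong n (λ i i<n → reflexive (≡.cong f (ℕₚ.+-∸-assoc 1 (ℕₚ.<⇒≤ i<n)))))
                (reflexive (≡.cong f (ℕₚ.m+n∸n≡m 1 n))) ⟩
    prod n (λ i → f (suc (n ∸ i))) * f 1        ≈⟨ *-congʳ (prod-reverse n (λ k → f (suc k))) ⟩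
    prod n (λ i → f (suc (suc i))) * f 1        ≈⟨ *-comm _ _ ⟩
    f 1 * prod n (λ i → f (suc (suc i)))        ≈⟨ prod-head n (λ i → f (suc i)) ⟨
    prod (suc n) (λ i → f (suc i))              ∎

  prod-^-step : ∀ n (F : ℕ → Carrier) →
                prod (suc n) (λ k → F k ^ (suc n ∸ k)) ≈ prod n (λ k → F k ^ (n ∸ k)) * prod (suc n) F
  prod-^-step n F = begin
    prod n (λ k → F k ^ (suc n ∸ k)) * F n ^ (suc n ∸ n)
      ≈⟨ *-cong (prod-cong n (λ k k<n → ^-congʳ (F k) (ℕₚ.+-∸-assoc 1 (ℕₚ.<⇒≤ k<n))))
                (^-congʳ (F n) (ℕₚ.m+n∸n≡m 1 n)) ⟩
    prod n (λ k → F k * F k ^ (n ∸ k)) * (F n * 1#)    ≈⟨ *-cong (prod-* n F _) (*-identityʳ (F n)) ⟩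
    prod n F * prod n (λ k → F k ^ (n ∸ k)) * F n      ≈⟨ *-congʳ (*-comm _ _) ⟩
    prod n (λ k → F k ^ (n ∸ k)) * prod n F * F n      ≈⟨ *-assoc _ _ _ ⟩
    prod n (λ k → F k ^ (n ∸ k)) * prod (suc n) F      ∎

  prod-pairs : ∀ n (f : ℕ → Carrier) → prod n (λ k → f (k ℕ.+ k) * f (suc (k ℕ.+ k))) ≈ prod (n ℕ.+ n) f
  prod-pairs zero    f = refl
  prod-pairs (suc n) f = begin
    prod n (λ k → f (k ℕ.+ k) * f (suc (k ℕ.+ k))) * (f (n ℕ.+ n) * f (suc (n ℕ.+ n)))
                                                           ≈⟨ *-congʳ (prod-pairs n f) ⟩
    prod (n ℕ.+ n) f * (f (n ℕ.+ n) * f (suc (n ℕ.+ n)))   ≈⟨ *-assoc _ _ _ ⟨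
    prod (suc (suc (n ℕ.+ n))) f                           ≡⟨ ≡.cong (λ k → prod (suc k) f) (ℕₚ.+-suc n n) ⟨
    prod (suc n ℕ.+ suc n) f                               ∎

  sum : ℕ → (ℕ → Carrier) → Carrier
  sum zero    f = 0#
  sum (suc n) f = f 0 + sum n (λ j → f (suc j))

  sum-cong : ∀ n {f g : ℕ → Carrier} → (∀ j → j < n → f j ≈ g j) → sum n f ≈ sum n g
  sum-cong zero    f≈g = refl
  sum-cong (suc n) f≈g = +-cong (f≈g 0 (s≤s z≤n)) (sum-cong n (λ j j<n → f≈g (suc j) (s≤s j<n)))

  sum-+ : ∀ n (f g : ℕ → Carrier) → sum n (λ j → f j + g j) ≈ sum n f + sum n g
  sum-+ zero    f g = sym (+-identityˡ 0#)
  sum-+ (suc n) f g = trans (+-congˡ (sum-+ n _ _)) (+-interchange _ _ _ _)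

  sum-*ˡ : ∀ n l (f : ℕ → Carrier) → sum n (λ j → l * f j) ≈ l * sum n f
  sum-*ˡ zero    l f = sym (zeroʳ l)
  sum-*ˡ (suc n) l f = trans (+-congˡ (sum-*ˡ n l _)) (sym (distribˡ l _ _))

  sum-zero : ∀ n {f : ℕ → Carrier} → (∀ j → j < n → f j ≈ 0#) → sum n f ≈ 0#
  sum-zero zero    f≈0 = refl
  sum-zero (suc n) f≈0 =
    trans (+-cong (f≈0 0 (s≤s z≤n)) (sum-zero n (λ j j<n → f≈0 (suc j) (s≤s j<n)))) (+-identityˡ 0#)

  sum-cancelling-pair : ∀ n c (f : ℕ → Carrier) → suc c < n →
                        (∀ j → j < n → j ≢ c → j ≢ suc c → f j ≈ 0#) → f c + f (suc c) ≈ 0# →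
                        sum n f ≈ 0#
  sum-cancelling-pair (suc (suc n)) zero f _ f≈0 pair = begin
    f 0 + (f 1 + sum n (λ j → f (suc (suc j))))   ≈⟨ +-assoc _ _ _ ⟨
    (f 0 + f 1) + sum n (λ j → f (suc (suc j)))
      ≈⟨ +-cong pair (sum-zero n (λ j j<n → f≈0 (suc (suc j)) (s≤s (s≤s j<n)) (λ ()) (λ ()))) ⟩
    0# + 0#                                       ≈⟨ +-identityˡ 0# ⟩
    0#                                            ∎
  sum-cancelling-pair (suc n) (suc c) f (s≤s c<n) f≈0 pair =
    trans (+-cong (f≈0 0 (s≤s z≤n) (λ ()) (λ ()))
                  (sum-cancelling-pair n c (λ j → f (suc j)) c<n
                    (λ j j<n j≢c j≢1+c →
                       f≈0 (suc j) (s≤s j<n) (j≢c ∘ ℕₚ.suc-injective) (j≢1+c ∘ ℕₚ.suc-injective))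
                    pair))
          (+-identityˡ 0#)

  -- Determinants by expansion along the first row

  -- Matrices are indexed by ℕ (Det n only reads the n × n block), and skip is punchIn on ℕ.
  Matrix : Set c
  Matrix = ℕ → ℕ → Carrier

  skip : ℕ → ℕ → ℕ
  skip zero    k       = suc k
  skip (suc j) zero    = zero
  skip (suc j) (suc k) = suc (skip j k)

  skip-< : ∀ {j k} → k < j → skip j k ≡ k
  skip-< {suc j} {zero}  _         = ≡.refl
  skip-< {suc j} {suc k} (s≤s k<j) = ≡.cong suc (skip-< k<j)

  skip-≥ : ∀ {j k} → j ≤ k → skip j k ≡ suc k
  skip-≥ {zero}          _         = ≡.refl
  skip-≥ {suc j} {suc k} (s≤s j≤k) = ≡.cong suc (skip-≥ j≤k)

  skip≤suc : ∀ j k → skip j k ≤ suc k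
  skip≤suc zero    k       = ℕₚ.≤-refl
  skip≤suc (suc j) zero    = z≤n
  skip≤suc (suc j) (suc k) = s≤s (skip≤suc j k)

  skip≢ : ∀ j k → skip j k ≢ j
  skip≢ zero    k       ()
  skip≢ (suc j) zero    ()
  skip≢ (suc j) (suc k) eq = skip≢ j k (ℕₚ.suc-injective eq)

  skip-injective : ∀ j {k l} → skip j k ≡ skip j l → k ≡ l
  skip-injective zero    eq = ℕₚ.suc-injective eq
  skip-injective (suc j) {zero}  {zero}  eq = ≡.refl
  skip-injective (suc j) {suc k} {suc l} eq = ≡.cong suc (skip-injective j (ℕₚ.suc-injective eq))

  skip-surjective : ∀ {n j c} → j < suc n → c < suc n → j ≢ c → ∃[ c′ ] c′ < n × skip j c′ ≡ c
  skip-surjective {j = j} {c} j<1+n c<1+n j≢c with ℕₚ.<-cmp j c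
  skip-surjective {c = suc c} _ (s≤s c<n) _ | tri< (s≤s j≤c) _ _ = c , c<n , skip-≥ j≤c
  ... | tri≈ _ j≡c _ = ⊥-elim (j≢c j≡c)
  ... | tri> _ _ c<j = c , ℕₚ.<-≤-trans c<j (ℕₚ.≤-pred j<1+n) , skip-< c<j

  skip-adjacent : ∀ {n j c} → j < suc n → suc c < suc n → j ≢ c → j ≢ suc c →
                  ∃[ c′ ] suc c′ < n × skip j c′ ≡ c × skip j (suc c′) ≡ suc c
  skip-adjacent {j = j} {c} j<1+n 1+c<1+n j≢c j≢1+c with ℕₚ.<-cmp j c
  skip-adjacent {c = suc c} _ (s≤s 2+c<n) _ _ | tri< (s≤s j≤c) _ _ =
    c , 2+c<n , skip-≥ j≤c , skip-≥ (ℕₚ.m≤n⇒m≤1+n j≤c)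
  ... | tri≈ _ j≡c _ = ⊥-elim (j≢c j≡c)
  ... | tri> _ _ c<j = c , ℕₚ.<-≤-trans 1+c<j (ℕₚ.≤-pred j<1+n) , skip-< c<j , skip-< 1+c<j
    where 1+c<j = ℕₚ.≤∧≢⇒< c<j (j≢1+c ∘ ≡.sym)

  toℕ-punchIn : ∀ {n} (j : Fin (suc n)) (k : Fin n) → toℕ (punchIn j k) ≡ skip (toℕ j) (toℕ k)
  toℕ-punchIn Fin.zero    k          = ≡.refl
  toℕ-punchIn (Fin.suc j) Fin.zero    = ≡.refl
  toℕ-punchIn (Fin.suc j) (Fin.suc k) = ≡.cong suc (toℕ-punchIn j k)

  minor : ℕ → Matrix → Matrix
  minor j M i k = M (suc i) (skip j k)

  Det : ℕ → Matrix → Carrier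
  Det zero    M = 1#
  Det (suc n) M = sum (suc n) (λ j → sign j * M 0 j * Det n (minor j M))

  det≈Det : ∀ n (M : Fin n → Fin n → Carrier) (N : Matrix) →
            (∀ i j → M i j ≈ N (toℕ i) (toℕ j)) → det n M ≈ Det n N
  det≈Det zero    M N M≈N = refl
  det≈Det (suc n) M N M≈N = sumFin≈sum (suc n) _ (λ j → sign j * N 0 j * Det n (minor j N)) term
    where
    sumFin≈sum : ∀ n (f : Fin n → Carrier) g → (∀ j → f j ≈ g (toℕ j)) → sumFin f ≈ sum n g
    sumFin≈sum zero    f g f≈g = refl
    sumFin≈sum (suc n) f g f≈g = +-cong (f≈g Fin.zero) (sumFin≈sum n _ _ (f≈g ∘ Fin.suc))
    term : ∀ j → sign (toℕ j) * M Fin.zero j * det n (λ i k → M (Fin.suc i) (punchIn j k))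
                 ≈ sign (toℕ j) * N 0 (toℕ j) * Det n (minor (toℕ j) N)
    term j = *-cong (*-congˡ (M≈N Fin.zero j)) (det≈Det n _ _ (λ i k →
      trans (M≈N (Fin.suc i) (punchIn j k)) (reflexive (≡.cong (N (suc (toℕ i))) (toℕ-punchIn j k)))))

  Det-cong : ∀ n {M N : Matrix} → (∀ i j → j < n → M i j ≈ N i j) → Det n M ≈ Det n N
  Det-cong zero    M≈N = refl
  Det-cong (suc n) {M} {N} M≈N = sum-cong (suc n) term
    where
    term : ∀ j → j < suc n → sign j * M 0 j * Det n (minor j M) ≈ sign j * N 0 j * Det n (minor j N)
    term j j<1+n = *-cong (*-congˡ (M≈N 0 j j<1+n))
      (Det-cong n (λ i k k<n → M≈N (suc i) (skip j k) (s≤s (ℕₚ.≤-trans (skip≤suc j k) k<n))))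

  Det-linear : ∀ n c (M P Q : Matrix) l → c < n →
               (∀ i j → j ≢ c → M i j ≈ P i j) → (∀ i j → j ≢ c → M i j ≈ Q i j) →
               (∀ i → M i c ≈ P i c + l * Q i c) → Det n M ≈ Det n P + l * Det n Q
  Det-linear (suc n) c M P Q l c<1+n M≈P M≈Q Mc = begin
    Det (suc n) M                                     ≈⟨ sum-cong (suc n) term ⟩
    sum (suc n) (λ j → T P j + l * T Q j)             ≈⟨ sum-+ (suc n) (T P) (λ j → l * T Q j) ⟩
    Det (suc n) P + sum (suc n) (λ j → l * T Q j)     ≈⟨ +-congˡ (sum-*ˡ (suc n) l (T Q)) ⟩
    Det (suc n) P + l * Det (suc n) Q                 ∎
    where
    T : Matrix → ℕ → Carrier
    T N j = sign j * N 0 j * Det n (minor j N)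
    term : ∀ j → j < suc n → T M j ≈ T P j + l * T Q j
    term j j<1+n with j ≟ c
    ... | yes ≡.refl = begin
      sign j * M 0 j * Det n (minor j M)                      ≈⟨ *-congʳ (*-congˡ (Mc 0)) ⟩
      sign j * (P 0 j + l * Q 0 j) * Det n (minor j M)
        ≈⟨ solve 5 (λ s p q l d → s :* (p :+ l :* q) :* d := s :* p :* d :+ l :* (s :* q :* d)) refl _ _ _ _ _ ⟩
      sign j * P 0 j * Det n (minor j M) + l * (sign j * Q 0 j * Det n (minor j M))
        ≈⟨ +-cong (*-congˡ (Det-cong n (λ i k _ → M≈P (suc i) (skip j k) (skip≢ j k))))
                  (*-congˡ (*-congˡ (Det-cong n (λ i k _ → M≈Q (suc i) (skip j k) (skip≢ j k))))) ⟩
      T P j + l * T Q j                                       ∎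
    ... | no j≢c with skip-surjective j<1+n c<1+n j≢c
    ... | c′ , c′<n , skip[j,c′]≡c = begin
      sign j * M 0 j * Det n (minor j M)
        ≈⟨ *-congˡ (Det-linear n c′ (minor j M) (minor j P) (minor j Q) l c′<n (off M≈P) (off M≈Q)
             (λ i → ≡.subst (λ z → M (suc i) z ≈ P (suc i) z + l * Q (suc i) z)
                            (≡.sym skip[j,c′]≡c) (Mc (suc i)))) ⟩
      sign j * M 0 j * (Det n (minor j P) + l * Det n (minor j Q))
        ≈⟨ solve 5 (λ s m p l q → s :* m :* (p :+ l :* q) := s :* m :* p :+ l :* (s :* m :* q)) refl _ _ _ _ _ ⟩
      sign j * M 0 j * Det n (minor j P) + l * (sign j * M 0 j * Det n (minor j Q))
        ≈⟨ +-cong (*-congʳ (*-congˡ (M≈P 0 j j≢c))) (*-congˡ (*-congʳ (*-congˡ (M≈Q 0 j j≢c)))) ⟩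
      T P j + l * T Q j                                       ∎
      where
      off : ∀ {N} → (∀ i j → j ≢ c → M i j ≈ N i j) → ∀ i k → k ≢ c′ → minor j M i k ≈ minor j N i k
      off M≈N i k k≢c′ =
        M≈N (suc i) (skip j k) (λ eq → k≢c′ (skip-injective j (≡.trans eq (≡.sym skip[j,c′]≡c))))

  Det-alternating : ∀ n c (M : Matrix) → suc c < n → (∀ i → M i c ≈ M i (suc c)) → Det n M ≈ 0#
  Det-alternating (suc n) c M 1+c<1+n Mc≈M[1+c] =
    sum-cancelling-pair (suc n) c (λ j → sign j * M 0 j * Det n (minor j M)) 1+c<1+n vanish cancel
    where
    vanish : ∀ j → j < suc n → j ≢ c → j ≢ suc c → sign j * M 0 j * Det n (minor j M) ≈ 0#
    vanish j j<1+n j≢c j≢1+c with skip-adjacent j<1+n 1+c<1+n j≢c j≢1+c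
    ... | c′ , 1+c′<n , skip[j,c′]≡c , skip[j,1+c′]≡1+c =
      trans (*-congˡ (Det-alternating n c′ (minor j M) 1+c′<n equal)) (zeroʳ _)
      where
      equal : ∀ i → minor j M i c′ ≈ minor j M i (suc c′)
      equal i = ≡.subst₂ (λ u v → M (suc i) u ≈ M (suc i) v)
                         (≡.sym skip[j,c′]≡c) (≡.sym skip[j,1+c′]≡1+c) (Mc≈M[1+c] (suc i))
    minors : ∀ i k → minor (suc c) M i k ≈ minor c M i k
    minors i k with ℕₚ.<-cmp k c
    ... | tri< k<c _ _ =
      reflexive (≡.cong (M (suc i)) (≡.trans (skip-< (ℕₚ.m<n⇒m<1+n k<c)) (≡.sym (skip-< k<c))))
    ... | tri≈ _ ≡.refl _ = ≡.subst₂ (λ u v → M (suc i) u ≈ M (suc i) v)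
      (≡.sym (skip-< (ℕₚ.n<1+n k))) (≡.sym (skip-≥ ℕₚ.≤-refl)) (Mc≈M[1+c] (suc i))
    ... | tri> _ _ c<k =
      reflexive (≡.cong (M (suc i)) (≡.trans (skip-≥ c<k) (≡.sym (skip-≥ (ℕₚ.<⇒≤ c<k)))))
    cancel : sign c * M 0 c * Det n (minor c M) + - sign c * M 0 (suc c) * Det n (minor (suc c) M) ≈ 0#
    cancel = begin
      sign c * M 0 c * Det n (minor c M) + - sign c * M 0 (suc c) * Det n (minor (suc c) M)
        ≈⟨ +-congˡ (*-cong (*-congˡ (sym (Mc≈M[1+c] 0))) (Det-cong n (λ i k _ → minors i k))) ⟩
      sign c * M 0 c * Det n (minor c M) + - sign c * M 0 c * Det n (minor c M)
        ≈⟨ solve 3 (λ s m d → s :* m :* d :+ (:- s) :* m :* d := con (+ 0)) refl _ _ _ ⟩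
      0#  ∎

  copyColumn : ℕ → ℕ → Matrix → Matrix
  copyColumn s t M i j with j ≟ t
  ... | yes _ = M i s
  ... | no  _ = M i j

  copyColumn-≡ : ∀ s t M i → copyColumn s t M i t ≡ M i s
  copyColumn-≡ s t M i with t ≟ t
  ... | yes _   = ≡.refl
  ... | no  t≢t = ⊥-elim (t≢t ≡.refl)

  copyColumn-≢ : ∀ s t M i {j} → j ≢ t → copyColumn s t M i j ≡ M i j
  copyColumn-≢ s t M i {j} j≢t with j ≟ t
  ... | yes j≡t = ⊥-elim (j≢t j≡t)
  ... | no  _   = ≡.refl

  Det-copyColumn-adjacent : ∀ n {s t} (M : Matrix) → s < n → t < n → suc s ≡ t ⊎ suc t ≡ s →
                            Det n (copyColumn s t M) ≈ 0#
  Det-copyColumn-adjacent n {s} M _ t<n (inj₁ ≡.refl) = Det-alternating n s _ t<n (λ i → reflexive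
    (≡.trans (copyColumn-≢ s (suc s) M i (ℕₚ.1+n≢n ∘ ≡.sym)) (≡.sym (copyColumn-≡ s (suc s) M i))))
  Det-copyColumn-adjacent n {t = t} M s<n _ (inj₂ ≡.refl) = Det-alternating n t _ s<n (λ i → reflexive
    (≡.trans (copyColumn-≡ (suc t) t M i) (≡.sym (copyColumn-≢ (suc t) t M i ℕₚ.1+n≢n))))

  Det-add-adjacent-column : ∀ n s t (M M′ : Matrix) l → s < n → t < n → suc s ≡ t ⊎ suc t ≡ s →
                            (∀ i j → j ≢ t → M′ i j ≈ M i j) → (∀ i → M′ i t ≈ M i t + l * M i s) →
                            Det n M′ ≈ Det n M
  Det-add-adjacent-column n s t M M′ l s<n t<n adjacent M′≈M M′t = begin
    Det n M′                                ≈⟨ Det-linear n t M′ M (copyColumn s t M) l t<n M′≈M M′≈copy M′t≈ ⟩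
    Det n M + l * Det n (copyColumn s t M)  ≈⟨ +-congˡ (*-congˡ (Det-copyColumn-adjacent n M s<n t<n adjacent)) ⟩
    Det n M + l * 0#                        ≈⟨ +-congˡ (zeroʳ l) ⟩
    Det n M + 0#                            ≈⟨ +-identityʳ _ ⟩
    Det n M                                 ∎
    where
    M′≈copy : ∀ i j → j ≢ t → M′ i j ≈ copyColumn s t M i j
    M′≈copy i j j≢t = trans (M′≈M i j j≢t) (reflexive (≡.sym (copyColumn-≢ s t M i j≢t)))
    M′t≈ : ∀ i → M′ i t ≈ M i t + l * copyColumn s t M i t
    M′t≈ i = trans (M′t i) (reflexive (≡.cong (λ z → M i t + l * z) (≡.sym (copyColumn-≡ s t M i))))

  Det-scale-rows : ∀ n (r : ℕ → Carrier) (M : Matrix) → Det n (λ i j → r i * M i j) ≈ prod n r * Det n M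
  Det-scale-rows zero    r M = sym (*-identityˡ 1#)
  Det-scale-rows (suc n) r M = begin
    Det (suc n) (λ i j → r i * M i j)                                   ≈⟨ sum-cong (suc n) term ⟩
    sum (suc n) (λ j → r 0 * prod n (r ∘ suc) * T j)                    ≈⟨ sum-*ˡ (suc n) _ T ⟩
    r 0 * prod n (r ∘ suc) * Det (suc n) M                              ≈⟨ *-congʳ (prod-head n r) ⟨
    prod (suc n) r * Det (suc n) M                                      ∎
    where
    T : ℕ → Carrier
    T j = sign j * M 0 j * Det n (minor j M)
    term : ∀ j → j < suc n → sign j * (r 0 * M 0 j) * Det n (λ i k → r (suc i) * minor j M i k)
                             ≈ r 0 * prod n (r ∘ suc) * T j
    term j _ = begin
      sign j * (r 0 * M 0 j) * Det n (λ i k → r (suc i) * minor j M i k)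
        ≈⟨ *-congˡ (Det-scale-rows n (r ∘ suc) (minor j M)) ⟩
      sign j * (r 0 * M 0 j) * (prod n (r ∘ suc) * Det n (minor j M))
        ≈⟨ solve 5 (λ s r m p d → s :* (r :* m) :* (p :* d) := r :* p :* (s :* m :* d)) refl _ _ _ _ _ ⟩
      r 0 * prod n (r ∘ suc) * T j ∎

  Det-unit-first-row : ∀ n (M : Matrix) → M 0 0 ≈ 1# → (∀ j → M 0 (suc j) ≈ 0#) →
                       Det (suc n) M ≈ Det n (minor 0 M)
  Det-unit-first-row n M M00≈1 M0j≈0 = begin
    1# * M 0 0 * Det n (minor 0 M) + sum n (λ j → - sign j * M 0 (suc j) * Det n (minor (suc j) M))
      ≈⟨ +-cong (*-congʳ (trans (*-identityˡ _) M00≈1)) (sum-zero n (λ j _ →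
           trans (*-congʳ (trans (*-congˡ (M0j≈0 j)) (zeroʳ _))) (zeroˡ _))) ⟩
    1# * Det n (minor 0 M) + 0#     ≈⟨ trans (+-identityʳ _) (*-identityˡ _) ⟩
    Det n (minor 0 M)               ∎

  -- The homogeneous Vandermonde determinant

  telescope : ∀ (f : ℕ → Carrier) k → (∀ q → q < k → f (suc q) ≈ f q) → f k ≈ f 0
  telescope f zero    _    = refl
  telescope f (suc k) step = trans (step k ℕₚ.≤-refl) (telescope f k (λ q q<k → step q (ℕₚ.m<n⇒m<1+n q<k)))

  columnsBelow : ℕ → Matrix → Matrix → Matrix
  columnsBelow q L R i j with j ℕₚ.<? q
  ... | yes _ = L i j
  ... | no  _ = R i j

  columnsBelow-< : ∀ q (L R : Matrix) i {j} → j < q → columnsBelow q L R i j ≡ L i j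
  columnsBelow-< q L R i {j} j<q with j ℕₚ.<? q
  ... | yes _   = ≡.refl
  ... | no  j≮q = ⊥-elim (j≮q j<q)

  columnsBelow-≥ : ∀ q (L R : Matrix) i {j} → q ≤ j → columnsBelow q L R i j ≡ R i j
  columnsBelow-≥ q L R i {j} q≤j with j ℕₚ.<? q
  ... | yes j<q = ⊥-elim (ℕₚ.<⇒≱ j<q q≤j)
  ... | no  _   = ≡.refl

  columnsBelow-suc : ∀ q (L R : Matrix) i {j} → j ≢ q → columnsBelow (suc q) L R i j ≡ columnsBelow q L R i j
  columnsBelow-suc q L R i {j} j≢q with ℕₚ.<-cmp j q
  ... | tri< j<q _ _ =
    ≡.trans (columnsBelow-< (suc q) L R i (ℕₚ.m<n⇒m<1+n j<q)) (≡.sym (columnsBelow-< q L R i j<q))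
  ... | tri≈ _ j≡q _ = ⊥-elim (j≢q j≡q)
  ... | tri> _ _ q<j =
    ≡.trans (columnsBelow-≥ (suc q) L R i q<j) (≡.sym (columnsBelow-≥ q L R i (ℕₚ.<⇒≤ q<j)))

  Vandermonde : ℕ → (ℕ → Carrier) → (ℕ → Carrier) → Matrix
  Vandermonde n a b i j = a i ^ (n ∸ suc j) * b i ^ j

  vandermondeBlock : ℕ → (ℕ → Carrier) → (ℕ → Carrier) → (ℕ → Carrier) → Matrix → Matrix
  vandermondeBlock m u a b = columnsBelow m (λ i j → u i * Vandermonde m a b i j)

  shear : Carrier → (ℕ → Carrier) → (ℕ → Carrier) → (ℕ → Carrier)
  shear t a b i = a i + t * b i

  ^-suc∸ : ∀ y {m k} → k < m → y ^ (m ∸ k) ≈ y * y ^ (m ∸ suc k)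
  ^-suc∸ y k<m = ^-congʳ y (ℕₚ.+-∸-assoc 1 k<m)

  ^-n∸n : ∀ y m → y ^ (m ∸ m) ≈ 1#
  ^-n∸n y m = ^-congʳ y (ℕₚ.n∸n≡0 m)

  -- Column m of the inner block is u b^m whatever the base, so it can serve as column m of the outer one.
  vandermondeBlock-suc : ∀ m u (a a′ b : ℕ → Carrier) K i j →
    vandermondeBlock m (λ i → u i * a′ i) a′ b (vandermondeBlock (suc m) u a b K) i j ≈
    vandermondeBlock (suc m) u a′ b K i j
  vandermondeBlock-suc m u a a′ b K i j with ℕₚ.<-cmp j m
  ... | tri< j<m _ _ = begin
    vandermondeBlock m (λ i → u i * a′ i) a′ b S i j    ≡⟨ columnsBelow-< m _ S i j<m ⟩
    u i * a′ i * (a′ i ^ (m ∸ suc j) * b i ^ j)         ≈⟨ *-assoc _ _ _ ⟩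
    u i * (a′ i * (a′ i ^ (m ∸ suc j) * b i ^ j))       ≈⟨ *-congˡ (*-assoc _ _ _) ⟨
    u i * (a′ i * a′ i ^ (m ∸ suc j) * b i ^ j)         ≈⟨ *-congˡ (*-congʳ (sym (^-suc∸ (a′ i) j<m))) ⟩
    u i * Vandermonde (suc m) a′ b i j                  ≡⟨ columnsBelow-< (suc m) _ K i (ℕₚ.m<n⇒m<1+n j<m) ⟨
    vandermondeBlock (suc m) u a′ b K i j               ∎
    where S = vandermondeBlock (suc m) u a b K
  ... | tri≈ _ ≡.refl _ = begin
    vandermondeBlock m (λ i → u i * a′ i) a′ b S i m    ≡⟨ columnsBelow-≥ m _ S i ℕₚ.≤-refl ⟩
    S i m                                               ≡⟨ columnsBelow-< (suc m) _ K i (ℕₚ.n<1+n m) ⟩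
    u i * (a i ^ (m ∸ m) * b i ^ m)
      ≈⟨ *-congˡ (*-congʳ (trans (^-n∸n (a i) m) (sym (^-n∸n (a′ i) m)))) ⟩
    u i * Vandermonde (suc m) a′ b i m                  ≡⟨ columnsBelow-< (suc m) _ K i (ℕₚ.n<1+n m) ⟨
    vandermondeBlock (suc m) u a′ b K i m               ∎
    where S = vandermondeBlock (suc m) u a b K
  ... | tri> _ _ m<j = reflexive (≡.trans (columnsBelow-≥ m _ _ i (ℕₚ.<⇒≤ m<j))
                         (≡.trans (columnsBelow-≥ (suc m) _ K i m<j) (≡.sym (columnsBelow-≥ (suc m) _ K i m<j))))

  -- Adding t times column q + 1 to column q, for q = 0, …, m - 1 in turn, replaces one factor a by a + t b
  -- in each of the first m columns.
  Det-shear-sweep : ∀ n (a b : ℕ → Carrier) t m → suc m ≤ n → ∀ u K →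
    Det n (vandermondeBlock m (λ i → u i * shear t a b i) a b (vandermondeBlock (suc m) u a b K)) ≈
    Det n (vandermondeBlock (suc m) u a b K)
  Det-shear-sweep n a b t m 1+m≤n u K = telescope (Det n ∘ T) m step
    where
    S L : Matrix
    S = vandermondeBlock (suc m) u a b K
    L i j = u i * shear t a b i * Vandermonde m a b i j
    T : ℕ → Matrix
    T q = columnsBelow q L S
    step : ∀ q → q < m → Det n (T (suc q)) ≈ Det n (T q)
    step q q<m = Det-add-adjacent-column n (suc q) q (T q) (T (suc q)) t
                   (ℕₚ.<-≤-trans (s≤s q<m) 1+m≤n) (ℕₚ.<-trans q<m 1+m≤n) (inj₂ ≡.refl)
                   (λ i j j≢q → reflexive (columnsBelow-suc q L S i j≢q)) on
      where
      on : ∀ i → T (suc q) i q ≈ T q i q + t * T q i (suc q)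
      on i = begin
        T (suc q) i q                                       ≡⟨ columnsBelow-< (suc q) L S i (ℕₚ.n<1+n q) ⟩
        u i * (a i + t * b i) * (A * b i ^ q)
          ≈⟨ solve 6 (λ u a t b A B → u :* (a :+ t :* b) :* (A :* B)
                                      := u :* (a :* A :* B) :+ t :* (u :* (A :* (b :* B))))
                     refl (u i) (a i) t (b i) A (b i ^ q) ⟩
        u i * (a i * A * b i ^ q) + t * (u i * (A * b i ^ suc q))
          ≈⟨ +-congʳ (*-congˡ (*-congʳ (sym (^-suc∸ (a i) q<m)))) ⟩
        u i * Vandermonde (suc m) a b i q + t * (u i * Vandermonde (suc m) a b i (suc q))
          ≡⟨ ≡.cong₂ (λ v w → v + t * w) (≡.sym (columnsBelow-< (suc m) _ K i (ℕₚ.m<n⇒m<1+n q<m)))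
                                          (≡.sym (columnsBelow-< (suc m) _ K i (s≤s q<m))) ⟩
        S i q + t * S i (suc q)
          ≡⟨ ≡.cong₂ (λ v w → v + t * w) (≡.sym (columnsBelow-≥ q L S i ℕₚ.≤-refl))
                                          (≡.sym (columnsBelow-≥ q L S i (ℕₚ.n≤1+n q))) ⟩
        T q i q + t * T q i (suc q)                         ∎
        where A = a i ^ (m ∸ suc q)

  Det-vandermondeBlock-shear : ∀ n (a b : ℕ → Carrier) t m → m ≤ n → ∀ u K →
    Det n (vandermondeBlock m u a b K) ≈ Det n (vandermondeBlock m u (shear t a b) b K)
  Det-vandermondeBlock-shear n a b t zero    _     u K = refl
  Det-vandermondeBlock-shear n a b t (suc m) 1+m≤n u K = begin
    Det n (vandermondeBlock (suc m) u a b K)     ≈⟨ Det-shear-sweep n a b t m 1+m≤n u K ⟨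
    Det n (vandermondeBlock m u′ a b S)          ≈⟨ Det-vandermondeBlock-shear n a b t m (ℕₚ.<⇒≤ 1+m≤n) u′ S ⟩
    Det n (vandermondeBlock m u′ a′ b S)         ≈⟨ Det-cong n (λ i j _ → vandermondeBlock-suc m u a a′ b K i j) ⟩
    Det n (vandermondeBlock (suc m) u a′ b K)    ∎
    where
    a′ = shear t a b
    u′ = λ i → u i * a′ i
    S = vandermondeBlock (suc m) u a b K

  Det-Vandermonde-shear : ∀ n (a b : ℕ → Carrier) t →
                          Det n (Vandermonde n a b) ≈ Det n (Vandermonde n (shear t a b) b)
  Det-Vandermonde-shear n a b t = begin
    Det n (Vandermonde n a b)                     ≈⟨ Det-cong n (λ i j j<n → sym (block a i j<n)) ⟩
    Det n (vandermondeBlock n (λ _ → 1#) a b K)   ≈⟨ Det-vandermondeBlock-shear n a b t n ℕₚ.≤-refl (λ _ → 1#) K ⟩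
    Det n (vandermondeBlock n (λ _ → 1#) a′ b K)  ≈⟨ Det-cong n (λ i j j<n → block a′ i j<n) ⟩
    Det n (Vandermonde n a′ b)                    ∎
    where
    a′ = shear t a b
    K : Matrix
    K _ _ = 0#
    block : ∀ α i {j} → j < n → vandermondeBlock n (λ _ → 1#) α b K i j ≈ Vandermonde n α b i j
    block α i j<n = trans (reflexive (columnsBelow-< n _ K i j<n)) (*-identityˡ _)

  eliminated : ℕ → (ℕ → Carrier) → (ℕ → Carrier) → Matrix
  eliminated n α b i j = (b i - b 0 * α i) * Vandermonde n α b i (ℕ.pred j)

  -- Subtracting b₀ times column j - 1 from column j, for j = n, …, 1 in turn.
  Det-Vandermonde-sweep : ∀ n (α b : ℕ → Carrier) →
    Det (suc n) (Vandermonde (suc n) α b) ≈ Det (suc n) (columnsBelow 1 (Vandermonde (suc n) α b) (eliminated n α b))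
  Det-Vandermonde-sweep n α b = begin
    Det (suc n) V           ≈⟨ Det-cong (suc n) (λ i j j<1+n → reflexive (columnsBelow-< (suc n) V E i j<1+n)) ⟨
    Det (suc n) (Y n)       ≈⟨ telescope (Det (suc n) ∘ Y) n step ⟩
    Det (suc n) (Y 0)       ∎
    where
    V E : Matrix
    V = Vandermonde (suc n) α b
    E = eliminated n α b
    Y : ℕ → Matrix
    Y q = columnsBelow (suc q) V E
    step : ∀ q → q < n → Det (suc n) (Y (suc q)) ≈ Det (suc n) (Y q)
    step q q<n = sym (Det-add-adjacent-column (suc n) q (suc q) (Y (suc q)) (Y q) (- b 0)
                        (ℕₚ.m<n⇒m<1+n q<n) (s≤s q<n) (inj₁ ≡.refl)
                        (λ i j j≢1+q → reflexive (≡.sym (columnsBelow-suc (suc q) V E i j≢1+q))) on)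
      where
      on : ∀ i → Y q i (suc q) ≈ Y (suc q) i (suc q) + - b 0 * Y (suc q) i q
      on i = begin
        Y q i (suc q)                                ≡⟨ columnsBelow-≥ (suc q) V E i ℕₚ.≤-refl ⟩
        (b i - b 0 * α i) * (A * b i ^ q)
          ≈⟨ solve 5 (λ b b₀ a A B → (b :- b₀ :* a) :* (A :* B) := A :* (b :* B) :+ (:- b₀) :* (a :* A :* B))
                     refl (b i) (b 0) (α i) A (b i ^ q) ⟩
        A * b i ^ suc q + - b 0 * (α i * A * b i ^ q)
          ≈⟨ +-congˡ (*-congˡ (*-congʳ (sym (^-suc∸ (α i) q<n)))) ⟩
        V i (suc q) + - b 0 * V i q
          ≡⟨ ≡.cong₂ (λ v w → v + - b 0 * w)
                     (≡.sym (columnsBelow-< (suc (suc q)) V E i ℕₚ.≤-refl))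
                     (≡.sym (columnsBelow-< (suc (suc q)) V E i (ℕₚ.m<n⇒m<1+n (ℕₚ.n<1+n q)))) ⟩
        Y (suc q) i (suc q) + - b 0 * Y (suc q) i q  ∎
        where A = α i ^ (n ∸ suc q)

  Det-Vandermonde-eliminate : ∀ n (α b : ℕ → Carrier) → α 0 ≈ 1# →
    Det (suc n) (Vandermonde (suc n) α b) ≈
    prod n (λ i → b (suc i) - b 0 * α (suc i)) * Det n (Vandermonde n (α ∘ suc) (b ∘ suc))
  Det-Vandermonde-eliminate n α b α0≈1 = begin
    Det (suc n) (Vandermonde (suc n) α b)  ≈⟨ Det-Vandermonde-sweep n α b ⟩
    Det (suc n) Y                          ≈⟨ Det-unit-first-row n Y Y00≈1 Y0j≈0 ⟩
    Det n (minor 0 Y)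
      ≈⟨ Det-cong n (λ i k _ → reflexive (columnsBelow-≥ 1 V E (suc i) (s≤s z≤n))) ⟩
    Det n (λ i k → d (suc i) * Vandermonde n (α ∘ suc) (b ∘ suc) i k)
      ≈⟨ Det-scale-rows n (d ∘ suc) _ ⟩
    prod n (d ∘ suc) * Det n (Vandermonde n (α ∘ suc) (b ∘ suc)) ∎
    where
    d : ℕ → Carrier
    d i = b i - b 0 * α i
    V E Y : Matrix
    V = Vandermonde (suc n) α b
    E = eliminated n α b
    Y = columnsBelow 1 V E
    Y00≈1 : Y 0 0 ≈ 1#
    Y00≈1 = begin
      Y 0 0                ≡⟨ columnsBelow-< 1 V E 0 (s≤s z≤n) ⟩
      α 0 ^ n * 1#         ≈⟨ *-identityʳ _ ⟩
      α 0 ^ n              ≈⟨ ^-congˡ n α0≈1 ⟩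
      1# ^ n               ≈⟨ 1#^n≈1# n ⟩
      1#                   ∎
    Y0j≈0 : ∀ j → Y 0 (suc j) ≈ 0#
    Y0j≈0 j = begin
      Y 0 (suc j)                                ≡⟨ columnsBelow-≥ 1 V E 0 (s≤s z≤n) ⟩
      (b 0 - b 0 * α 0) * Vandermonde n α b 0 j  ≈⟨ *-congʳ (+-congˡ (-‿cong (*-congˡ α0≈1))) ⟩
      (b 0 - b 0 * 1#) * Vandermonde n α b 0 j   ≈⟨ *-congʳ (+-congˡ (-‿cong (*-identityʳ _))) ⟩
      (b 0 - b 0) * Vandermonde n α b 0 j        ≈⟨ *-congʳ (-‿inverseʳ _) ⟩
      0# * Vandermonde n α b 0 j                 ≈⟨ zeroˡ _ ⟩
      0#                                         ∎

  Δ : ℕ → (ℕ → Carrier) → (ℕ → Carrier) → Carrier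
  Δ n a b = prod n (λ j → prod j (λ i → a i * b j - a j * b i))

  Δ-head : ∀ n (a b : ℕ → Carrier) →
           Δ (suc n) a b ≈ prod n (λ j → a 0 * b (suc j) - a (suc j) * b 0) * Δ n (a ∘ suc) (b ∘ suc)
  Δ-head n a b = begin
    Δ (suc n) a b
      ≈⟨ prod-head n _ ⟩
    1# * prod n (λ j → prod (suc j) (λ i → a i * b (suc j) - a (suc j) * b i))
      ≈⟨ *-identityˡ _ ⟩
    prod n (λ j → prod (suc j) (λ i → a i * b (suc j) - a (suc j) * b i))
      ≈⟨ prod-cong n (λ j _ → prod-head j _) ⟩
    prod n (λ j → (a 0 * b (suc j) - a (suc j) * b 0) * prod j (λ i → a (suc i) * b (suc j) - a (suc j) * b (suc i)))
      ≈⟨ prod-* n _ _ ⟩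
    prod n (λ j → a 0 * b (suc j) - a (suc j) * b 0) * Δ n (a ∘ suc) (b ∘ suc) ∎

  Δ-shear : ∀ n (a b : ℕ → Carrier) t → Δ n (shear t a b) b ≈ Δ n a b
  Δ-shear n a b t = prod-cong n (λ j _ → prod-cong j (λ i _ →
    solve 5 (λ aᵢ aⱼ bᵢ bⱼ t → (aᵢ :+ t :* bᵢ) :* bⱼ :- (aⱼ :+ t :* bⱼ) :* bᵢ := aᵢ :* bⱼ :- aⱼ :* bᵢ)
      refl (a i) (a j) (b i) (b j) t))

  -- The hypothesis stands in for division by a 0: it lets a shear make a 0 = 1.
  Det-Vandermonde : ∀ n (a b : ℕ → Carrier) → (∀ i → ∃[ t ] a i + t * b i ≈ 1#) →
                    Det n (Vandermonde n a b) ≈ Δ n a b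
  Det-Vandermonde zero    a b unimodular = refl
  Det-Vandermonde (suc n) a b unimodular = begin
    Det (suc n) (Vandermonde (suc n) a b)      ≈⟨ Det-Vandermonde-shear (suc n) a b t ⟩
    Det (suc n) (Vandermonde (suc n) a′ b)     ≈⟨ Det-Vandermonde-eliminate n a′ b a′0≈1 ⟩
    prod n (λ j → b (suc j) - b 0 * a′ (suc j)) * Det n (Vandermonde n (a′ ∘ suc) (b ∘ suc))
      ≈⟨ *-cong (prod-cong n (λ j _ → factor j)) (Det-Vandermonde n (a′ ∘ suc) (b ∘ suc) unimodular′) ⟩
    prod n (λ j → a′ 0 * b (suc j) - a′ (suc j) * b 0) * Δ n (a′ ∘ suc) (b ∘ suc)
                                               ≈⟨ Δ-head n a′ b ⟨
    Δ (suc n) a′ b                             ≈⟨ Δ-shear (suc n) a b t ⟩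
    Δ (suc n) a b                              ∎
    where
    t = proj₁ (unimodular 0)
    a′ = shear t a b
    a′0≈1 : a′ 0 ≈ 1#
    a′0≈1 = proj₂ (unimodular 0)
    factor : ∀ j → b (suc j) - b 0 * a′ (suc j) ≈ a′ 0 * b (suc j) - a′ (suc j) * b 0
    factor j = begin
      b (suc j) - b 0 * a′ (suc j)             ≈⟨ +-cong (*-identityˡ _) (-‿cong (*-comm _ _)) ⟨
      1# * b (suc j) - a′ (suc j) * b 0        ≈⟨ +-congʳ (*-congʳ a′0≈1) ⟨
      a′ 0 * b (suc j) - a′ (suc j) * b 0      ∎
    unimodular′ : ∀ i → ∃[ s ] a′ (suc i) + s * b (suc i) ≈ 1#
    unimodular′ i with unimodular (suc i)
    ... | tᵢ , eq = tᵢ - t , trans (solve 4 (λ a b t s → (a :+ t :* b) :+ (s :- t) :* b := a :+ s :* b)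
                                           refl (a (suc i)) (b (suc i)) t tᵢ) eq

  -- With 0-based indices, row i of matA x n is a i times row i of Vandermonde n a b.
  module MatrixA (x : Carrier) where

    1-x^ : ℕ → Carrier
    1-x^ m = 1# - x ^ m

    a b : ℕ → Carrier
    a i = 1-x^ (suc i) * 1-x^ (suc (suc i))
    b i = x ^ suc i

    a+tb≈1 : ∀ i → ∃[ t ] a i + t * b i ≈ 1#
    a+tb≈1 i = 1# + x - x * b i ,
      solve 2 (λ x y → (con (+ 1) :- y) :* (con (+ 1) :- x :* y) :+ (con (+ 1) :+ x :- x :* y) :* y := con (+ 1))
              refl x (b i)

    a-b-cross : ∀ {i j} → i ≤ j → a i * b j - a j * b i ≈ - b i * 1-x^ (j ∸ i) * 1-x^ (3 ℕ.+ j ℕ.+ i)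
    a-b-cross {i} {j} i≤j = begin
      f X * (x * x ^ j) - f (x ^ j) * (x * X)
        ≈⟨ +-cong (*-congˡ (*-congˡ xʲ≈XW)) (-‿cong (*-congʳ (f-cong xʲ≈XW))) ⟩
      f X * (x * (X * W)) - f (X * W) * (x * X)
        ≈⟨ solve 3 (λ x X W →
               (con (+ 1) :- x :* X) :* (con (+ 1) :- x :* (x :* X)) :* (x :* (X :* W))
               :- (con (+ 1) :- x :* (X :* W)) :* (con (+ 1) :- x :* (x :* (X :* W))) :* (x :* X)
               := :- (x :* X) :* (con (+ 1) :- W) :* (con (+ 1) :- x :* (x :* (x :* (X :* W :* X)))))
             refl x X W ⟩
      - (x * X) * (1# - W) * (1# - x * (x * (x * (X * W * X))))
        ≈⟨ *-congˡ (+-congˡ (-‿cong (*-congˡ (*-congˡ (*-congˡ (sym xʲ⁺ⁱ≈XWX)))))) ⟩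
      - b i * 1-x^ (j ∸ i) * 1-x^ (3 ℕ.+ j ℕ.+ i)  ∎
      where
      f : Carrier → Carrier
      f y = (1# - x * y) * (1# - x * (x * y))
      f-cong : ∀ {y z} → y ≈ z → f y ≈ f z
      f-cong y≈z = *-cong (+-congˡ (-‿cong (*-congˡ y≈z))) (+-congˡ (-‿cong (*-congˡ (*-congˡ y≈z))))
      X W : Carrier
      X = x ^ i
      W = x ^ (j ∸ i)
      xʲ≈XW : x ^ j ≈ X * W
      xʲ≈XW = trans (^-congʳ x (≡.sym (ℕₚ.m+[n∸m]≡n i≤j))) (^-homo-* x i (j ∸ i))
      xʲ⁺ⁱ≈XWX : x ^ (j ℕ.+ i) ≈ X * W * X
      xʲ⁺ⁱ≈XWX = trans (^-homo-* x j i) (*-congʳ xʲ≈XW)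

    prod-b : ∀ n → prod n b ≈ x ^ (suc n C 2)
    prod-b zero    = refl
    prod-b (suc n) = begin
      prod n b * x ^ suc n               ≈⟨ *-congʳ (prod-b n) ⟩
      x ^ (suc n C 2) * x ^ suc n        ≈⟨ ^-homo-* x (suc n C 2) (suc n) ⟨
      x ^ (suc n C 2 ℕ.+ suc n)          ≡⟨ ≡.cong (x ^_) ([1+n]C2≡nC2+n (suc n)) ⟨
      x ^ (suc (suc n) C 2)              ∎

    prod-a*Δ-step : ∀ n → a n * prod n (λ i → a i * b n - a n * b i) ≈
                        sign n * x ^ (suc n C 2) * prod (suc n ℕ.+ suc n) (1-x^ ∘ suc)
    prod-a*Δ-step n = begin
      a n * prod n (λ i → a i * b n - a n * b i)
        ≈⟨ *-congˡ (prod-cong n (λ i i<n → a-b-cross (ℕₚ.<⇒≤ i<n))) ⟩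
      a n * prod n (λ i → - b i * 1-x^ (n ∸ i) * 1-x^ (3 ℕ.+ n ℕ.+ i))
        ≈⟨ *-congˡ (trans (prod-* n _ _) (*-congʳ (prod-* n _ _))) ⟩
      a n * (prod n (λ i → - b i) * prod n (λ i → 1-x^ (n ∸ i)) * S)
        ≈⟨ *-congˡ (*-congʳ (*-cong (trans (prod-neg n b) (*-congˡ (prod-b n))) (prod-reverse n 1-x^))) ⟩
      a n * (sign n * x ^ (suc n C 2) * prod n (1-x^ ∘ suc) * S)
        ≈⟨ solve 6 (λ g₁ g₂ s p F S → (g₁ :* g₂) :* (s :* p :* F :* S) := s :* p :* (F :* (g₁ :* (g₂ :* S))))
             refl (1-x^ (suc n)) (1-x^ (suc (suc n))) (sign n) (x ^ (suc n C 2)) (prod n (1-x^ ∘ suc)) S ⟩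
      sign n * x ^ (suc n C 2) * (prod n (1-x^ ∘ suc) * (1-x^ (suc n) * (1-x^ (suc (suc n)) * S)))
        ≈⟨ *-congˡ split ⟨
      sign n * x ^ (suc n C 2) * prod (suc n ℕ.+ suc n) (1-x^ ∘ suc) ∎
      where
      S = prod n (λ i → 1-x^ (3 ℕ.+ n ℕ.+ i))
      split : prod (suc n ℕ.+ suc n) (1-x^ ∘ suc) ≈ prod n (1-x^ ∘ suc) * (1-x^ (suc n) * (1-x^ (suc (suc n)) * S))
      split = begin
        prod (suc n ℕ.+ suc n) (1-x^ ∘ suc)      ≡⟨ ≡.cong (λ k → prod k (1-x^ ∘ suc)) (ℕₚ.+-suc n (suc n)) ⟨
        prod (n ℕ.+ suc (suc n)) (1-x^ ∘ suc)    ≈⟨ prod-+ n (suc (suc n)) _ ⟩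
        prod n (1-x^ ∘ suc) * prod (suc (suc n)) (λ i → 1-x^ (suc (n ℕ.+ i)))
          ≈⟨ *-congˡ (trans (prod-head (suc n) _) (*-congˡ (prod-head n _))) ⟩
        prod n (1-x^ ∘ suc) * (1-x^ (suc (n ℕ.+ 0)) * (1-x^ (suc (n ℕ.+ 1)) * S′))
          ≡⟨ ≡.cong₂ (λ u v → prod n (1-x^ ∘ suc) * (1-x^ (suc u) * (1-x^ (suc v) * S′)))
                     (ℕₚ.+-identityʳ n) (ℕₚ.+-comm n 1) ⟩
        prod n (1-x^ ∘ suc) * (1-x^ (suc n) * (1-x^ (suc (suc n)) * S′))
          ≈⟨ *-congˡ (*-congˡ (*-congˡ (prod-cong n (λ i _ → reflexive (≡.cong (1-x^ ∘ suc)
               (≡.trans (ℕₚ.+-suc n (suc i)) (≡.cong suc (ℕₚ.+-suc n i)))))))) ⟩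
        prod n (1-x^ ∘ suc) * (1-x^ (suc n) * (1-x^ (suc (suc n)) * S)) ∎
        where S′ = prod n (λ i → 1-x^ (suc (n ℕ.+ suc (suc i))))

    pairFactor : ℕ → Carrier
    pairFactor k = 1-x^ (suc (k ℕ.+ k)) * 1-x^ (suc (suc (k ℕ.+ k)))

    closedForm : ℕ → Carrier
    closedForm n = sign (n C 2) * x ^ (suc n C 3) * prod n (λ k → pairFactor k ^ (n ∸ k))

    prod-a*Δ : ∀ n → prod n a * Δ n a b ≈ closedForm n
    prod-a*Δ zero    = sym (*-identityʳ _)
    prod-a*Δ (suc n) = begin
      prod n a * a n * (Δ n a b * prod n (λ i → a i * b n - a n * b i))
        ≈⟨ interchange _ _ _ _ ⟩
      prod n a * Δ n a b * (a n * prod n (λ i → a i * b n - a n * b i))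
        ≈⟨ *-cong (prod-a*Δ n) (prod-a*Δ-step n) ⟩
      sign (n C 2) * x ^ (suc n C 3) * P * (sign n * x ^ (suc n C 2) * E)
        ≈⟨ solve 6 (λ s X P s′ X′ E → s :* X :* P :* (s′ :* X′ :* E) := s :* s′ :* (X :* X′) :* (P :* E))
             refl (sign (n C 2)) (x ^ (suc n C 3)) P (sign n) (x ^ (suc n C 2)) E ⟩
      sign (n C 2) * sign n * (x ^ (suc n C 3) * x ^ (suc n C 2)) * (P * E)
        ≈⟨ *-cong (*-cong (sign-+ (n C 2) n) (^-homo-* x (suc n C 3) (suc n C 2)))
                  (trans (prod-^-step n pairFactor) (*-congˡ (prod-pairs (suc n) (1-x^ ∘ suc)))) ⟨
      sign (n C 2 ℕ.+ n) * x ^ (suc n C 3 ℕ.+ suc n C 2) * P′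
        ≡⟨ ≡.cong₂ (λ e f → sign e * x ^ f * P′) ([1+n]C2≡nC2+n n) ([1+n]C3≡nC3+nC2 (suc n)) ⟨
      closedForm (suc n) ∎
      where
      P = prod n (λ k → pairFactor k ^ (n ∸ k))
      P′ = prod (suc n) (λ k → pairFactor k ^ (suc n ∸ k))
      E = prod (suc n ℕ.+ suc n) (1-x^ ∘ suc)

    pow[1-pow]≡1-x^^ : ∀ m e → pow (1# - pow x m) e ≡ 1-x^ m ^ e
    pow[1-pow]≡1-x^^ m e = ≡.trans (≡.cong (λ y → pow (1# - y) e) (pow≡^ x m)) (pow≡^ _ e)

    matA≈aV : ∀ n (i j : Fin n) → matA x n i j ≈ a (toℕ i) * Vandermonde n a b (toℕ i) (toℕ j)
    matA≈aV n i j = begin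
      matA x n i j
        ≡⟨ ≡.cong₂ _*_ (≡.cong₂ _*_ (pow[1-pow]≡1-x^^ (suc I) (n ∸ J))
                                    (pow[1-pow]≡1-x^^ (suc (suc I)) (n ∸ J)))
                       (pow≡^ x (suc I ℕ.* J)) ⟩
      1-x^ (suc I) ^ (n ∸ J) * 1-x^ (suc (suc I)) ^ (n ∸ J) * x ^ (suc I ℕ.* J)
        ≈⟨ *-cong (^-distrib-* _ _ (n ∸ J)) (^-assocʳ x (suc I) J) ⟨
      a I ^ (n ∸ J) * b I ^ J                  ≈⟨ *-congʳ (^-suc∸ (a I) (Finₚ.toℕ<n j)) ⟩
      a I * a I ^ (n ∸ suc J) * b I ^ J        ≈⟨ *-assoc _ _ _ ⟩
      a I * Vandermonde n a b I J              ∎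
      where
      I = toℕ i
      J = toℕ j

    rhsA≈closedForm : ∀ n → rhsA x n ≈ closedForm n
    rhsA≈closedForm n = begin
      rhsA x n
        ≡⟨ ≡.cong₂ (λ e p → sign e * p * prodFrom1 F n) (n*[n∸1]/2≡nC2 n)
                   (≡.trans (pow≡^ x (n ℕ.* (n ℕ.* n ∸ 1) / 6)) (≡.cong (x ^_) (n*[n*n∸1]/6≡[1+n]C3 n))) ⟩
      sign (n C 2) * x ^ (suc n C 3) * prodFrom1 F n
        ≡⟨ ≡.cong (sign (n C 2) * x ^ (suc n C 3) *_) (prodFrom1≡prod F n) ⟩
      sign (n C 2) * x ^ (suc n C 3) * prod n (F ∘ suc)
        ≈⟨ *-congˡ (prod-cong n (λ k _ → factor k)) ⟩
      closedForm n ∎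
      where
      2*[1+k]≡2+[k+k] : ∀ k → 2 ℕ.* suc k ≡ suc (suc (k ℕ.+ k))
      2*[1+k]≡2+[k+k] = solve-∀
      F : ℕ → Carrier
      F k = pow (1# - pow x (2 ℕ.* k ∸ 1)) (suc n ∸ k) * pow (1# - pow x (2 ℕ.* k)) (suc n ∸ k)
      factor : ∀ k → F (suc k) ≈ pairFactor k ^ (n ∸ k)
      factor k = begin
        F (suc k)
          ≡⟨ ≡.cong₂ _*_
               (≡.trans (pow[1-pow]≡1-x^^ (2 ℕ.* suc k ∸ 1) (n ∸ k))
                        (≡.cong (λ m → 1-x^ (m ∸ 1) ^ (n ∸ k)) (2*[1+k]≡2+[k+k] k)))
               (≡.trans (pow[1-pow]≡1-x^^ (2 ℕ.* suc k) (n ∸ k))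
                        (≡.cong (λ m → 1-x^ m ^ (n ∸ k)) (2*[1+k]≡2+[k+k] k))) ⟩
        1-x^ (suc (k ℕ.+ k)) ^ (n ∸ k) * 1-x^ (suc (suc (k ℕ.+ k))) ^ (n ∸ k)
          ≈⟨ ^-distrib-* _ _ (n ∸ k) ⟨
        pairFactor k ^ (n ∸ k) ∎

lemma2p8 : ∀ {c ℓ} (R : CommutativeRing c ℓ) (x : CommutativeRing.Carrier R) (n : ℕ) → 1 ≤ n →
    CommutativeRing._≈_ R (RingDefs.det R n (RingDefs.matA R x n)) (RingDefs.rhsA R x n)
lemma2p8 R x n _ = begin
  det n (matA x n)                               ≈⟨ det≈Det n (matA x n) _ (matA≈aV n) ⟩
  Det n (λ i j → a i * Vandermonde n a b i j)    ≈⟨ Det-scale-rows n a (Vandermonde n a b) ⟩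
  prod n a * Det n (Vandermonde n a b)           ≈⟨ *-congˡ (Det-Vandermonde n a b a+tb≈1) ⟩
  prod n a * Δ n a b                             ≈⟨ prod-a*Δ n ⟩
  closedForm n                                   ≈⟨ rhsA≈closedForm n ⟨
  rhsA x n                                       ∎
  where
  open CommutativeRing R
  open RingDefs R
  open Determinants R
  open MatrixA x
  open import Relation.Binary.Reasoning.Setoid setoid
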